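{- $\sqsupseteq_{CS}^\Delta$ is a precongruence for internal choice: for all CSP processes $P_1,P_2,Q_1,Q_2$, if $P_1\sqsupseteq_{CS}^\Delta Q_1$ and $P_2\sqsupseteq_{CS}^\Delta Q_2$ then $P_1\sqcap P_2\sqsupseteq_{CS}^\Delta Q_1\sqcap Q_2$.
   Context: Fix a set $\Sigma$ of communications and an internal action $\tau\notin\Sigma$; $a$ ranges over $\Sigma$ and $\alpha$ over $\Sigma\cup\{\tau\}$. CSP expressions are generated by $P,Q ::= \mathrm{STOP}\mid \mathrm{div}\mid a\to P\mid P\sqcap Q\mid P\,\Box\,Q\mid P\rhd Q\mid P\,\|_A\,Q\mid P\setminus A\mid f(P)\mid P\,\triangle\,Q\mid P\,\Theta_A\,Q\mid X\mid \mu X.P$, with $A\subseteq\Sigma$, $f:\Sigma\to\Sigma$ (extended by $f(\tau)=\tau$), $X$ a process identifier. A CSP process is an expression in which every occurrence of an identifier $X$ lies within a subexpression $\mu X.P$. Transitions $P\xrightarrow{\alpha}P'$ are the least relations such that: $\mathrm{div}\xrightarrow{\tau}\mathrm{div}$; $(a\to P)\xrightarrow{a}P$; $P\sqcap Q\xrightarrow{\tau}P$, $P\sqcap Q\xrightarrow{\tau}Q$; if $P\xrightarrow{a}P'$ then $P\Box Q\xrightarrow{a}P'$, $Q\Box P\xrightarrow{a}P'$, $P\rhd Q\xrightarrow{a}P'$; if $P\xrightarrow{\tau}P'$ then $P\Box Q\xrightarrow{\tau}P'\Box Q$, $Q\Box P\xrightarrow{\tau}Q\Box P'$, $P\rhd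 Q\xrightarrow{\tau}P'\rhd Q$; $P\rhd Q\xrightarrow{\tau}Q$; if $P\xrightarrow{\alpha}P'$ then $f(P)\xrightarrow{f(\alpha)}f(P')$; if $P\xrightarrow{\alpha}P'$, $\alpha\notin A$, then $P\|_AQ\xrightarrow{\alpha}P'\|_AQ$, $Q\|_AP\xrightarrow{\alpha}Q\|_AP'$, $P\setminus A\xrightarrow{\alpha}P'\setminus A$, $P\Theta_AQ\xrightarrow{\alpha}P'\Theta_AQ$; if $P\xrightarrow{a}P'$, $Q\xrightarrow{a}Q'$, $a\in A$, then $P\|_AQ\xrightarrow{a}P'\|_AQ'$; if $P\xrightarrow{a}P'$, $a\in A$, then $P\setminus A\xrightarrow{\tau}P'\setminus A$ and $P\Theta_AQ\xrightarrow{a}Q$; if $P\xrightarrow{\alpha}P'$ then $P\triangle Q\xrightarrow{\alpha}P'\triangle Q$; if $Q\xrightarrow{\tau}Q'$ then $P\triangle Q\xrightarrow{\tau}P\triangle Q'$; if $Q\xrightarrow{a}Q'$ then $P\triangle Q\xrightarrow{a}Q'$; $\mu X.P\xrightarrow{\tau}P[\mu X.P/X]$. Write $P\Rightarrow Q$ if $P=P_0\xrightarrow{\tau}\cdots\xrightarrow{\tau}P_n=Q$ ($n\ge 0$); $P\overset{\alpha}{\Rightarrow}Q$ if $P\Rightarrow P'\xrightarrow{\alpha}Q'\Rightarrow Q$; $P\overset{\hat\alpha}{\Rightarrow}Q$ means $P\overset{\alpha}{\Rightarrow}Q$ if $\alpha\in\Sigma$ and $P\Rightarrow Q$ if $\alpha=\tau$.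 $P{\Uparrow}$ ($P$ diverges) if there are $P_0,P_1,\dots$ with $P\Rightarrow P_0\xrightarrow{\tau}P_1\xrightarrow{\tau}\cdots$. A coupled simulation is a relation $\mathcal R$ on CSP processes such that (i) if $P\mathcal RQ$ and $P\xrightarrow{\alpha}P'$ then $Q\overset{\hat\alpha}{\Rightarrow}Q'$ with $P'\mathcal RQ'$ for some $Q'$, and (ii) if $P\mathcal RQ$ then $Q\Rightarrow Q'$ with $Q'\mathcal RP$ for some $Q'$; it is divergence-preserving if $P\mathcal RQ$ and $P{\Uparrow}$ imply $Q{\Uparrow}$. $P\sqsupseteq_{CS}^\Delta Q$ (also written $Q\sqsubseteq_{CS}^\Delta P$) iff $P\mathcal RQ$ for some divergence-preserving coupled simulation $\mathcal R$; $P\equiv_{CS}^\Delta Q$ iff $P\sqsupseteq_{CS}^\Delta Q$ and $Q\sqsupseteq_{CS}^\Delta P$. -}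

module Defs where

open import Data.Nat using (ℕ; suc)
open import Data.Product using (Σ-syntax; ∃-syntax; _×_; _,_)
open import Relation.Nullary using (¬_; yes; no)
open import Relation.Binary.PropositionalEquality using (_≡_)
open import Data.Nat.Properties using (_≟_)

Ident : Set
Ident = ℕ

-- CSP expressions over a communication alphabet Σ.
-- A subset A ⊆ Σ is a predicate  Σ → Set.
infixr 6 _⇒_
infixl 5 _⊓_ _□_ _▷_ _△_
data Expr (Σ : Set) : Set₁ where
  STOP  : Expr Σ
  div   : Expr Σ
  _⇒_   : Σ → Expr Σ → Expr Σ
  _⊓_   : Expr Σ → Expr Σ → Expr Σ
  _□_   : Expr Σ → Expr Σ → Expr Σ
  _▷_   : Expr Σ → Expr Σ → Expr Σ
  par   : (Σ → Set) → Expr Σ → Expr Σ → Expr Σ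
  hide  : Expr Σ → (Σ → Set) → Expr Σ
  ren   : (Σ → Σ) → Expr Σ → Expr Σ
  _△_   : Expr Σ → Expr Σ → Expr Σ
  thr   : (Σ → Set) → Expr Σ → Expr Σ → Expr Σ
  var   : Ident → Expr Σ
  μ     : Ident → Expr Σ → Expr Σ

data Act (Σ : Set) : Set where
  τ  : Act Σ
  ev : Σ → Act Σ

renAct : {Σ : Set} → (Σ → Σ) → Act Σ → Act Σ
renAct f τ      = τ
renAct f (ev a) = ev (f a)

_∈ₐ_ : {Σ : Set} → Act Σ → (Σ → Set) → Set
τ    ∈ₐ A = ⊥' where data ⊥' : Set where
ev a ∈ₐ A = A a

data FreeIn {Σ : Set} (X : Ident) : Expr Σ → Set₁ where
  f-var  : FreeIn X (var X)
  f-pre  : ∀ {a P} → FreeIn X P → FreeIn X (a ⇒ P)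
  f-⊓l   : ∀ {P Q} → FreeIn X P → FreeIn X (P ⊓ Q)
  f-⊓r   : ∀ {P Q} → FreeIn X Q → FreeIn X (P ⊓ Q)
  f-□l   : ∀ {P Q} → FreeIn X P → FreeIn X (P □ Q)
  f-□r   : ∀ {P Q} → FreeIn X Q → FreeIn X (P □ Q)
  f-▷l   : ∀ {P Q} → FreeIn X P → FreeIn X (P ▷ Q)
  f-▷r   : ∀ {P Q} → FreeIn X Q → FreeIn X (P ▷ Q)
  f-parl : ∀ {A P Q} → FreeIn X P → FreeIn X (par A P Q)
  f-parr : ∀ {A P Q} → FreeIn X Q → FreeIn X (par A P Q)
  f-hide : ∀ {A P} → FreeIn X P → FreeIn X (hide P A)
  f-ren  : ∀ {f P} → FreeIn X P → FreeIn X (ren f P)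
  f-△l   : ∀ {P Q} → FreeIn X P → FreeIn X (P △ Q)
  f-△r   : ∀ {P Q} → FreeIn X Q → FreeIn X (P △ Q)
  f-thrl : ∀ {A P Q} → FreeIn X P → FreeIn X (thr A P Q)
  f-thrr : ∀ {A P Q} → FreeIn X Q → FreeIn X (thr A P Q)
  f-μ    : ∀ {Y P} → ¬ (X ≡ Y) → FreeIn X P → FreeIn X (μ Y P)

Process : {Σ : Set} → Expr Σ → Set₁
Process P = ∀ X → ¬ FreeIn X P

_[_/_] : {Σ : Set} → Expr Σ → Expr Σ → Ident → Expr Σ
STOP        [ Q / X ] = STOP
div         [ Q / X ] = div
(a ⇒ P)     [ Q / X ] = a ⇒ (P [ Q / X ])
(P₁ ⊓ P₂)   [ Q / X ] = (P₁ [ Q / X ]) ⊓ (P₂ [ Q / X ])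
(P₁ □ P₂)   [ Q / X ] = (P₁ [ Q / X ]) □ (P₂ [ Q / X ])
(P₁ ▷ P₂)   [ Q / X ] = (P₁ [ Q / X ]) ▷ (P₂ [ Q / X ])
par A P₁ P₂ [ Q / X ] = par A (P₁ [ Q / X ]) (P₂ [ Q / X ])
hide P A    [ Q / X ] = hide (P [ Q / X ]) A
ren f P     [ Q / X ] = ren f (P [ Q / X ])
(P₁ △ P₂)   [ Q / X ] = (P₁ [ Q / X ]) △ (P₂ [ Q / X ])
thr A P₁ P₂ [ Q / X ] = thr A (P₁ [ Q / X ]) (P₂ [ Q / X ])
var Y       [ Q / X ] with Y ≟ X
... | yes _ = Q
... | no  _ = var Y
μ Y P       [ Q / X ] with Y ≟ X
... | yes _ = μ Y P
... | no  _ = μ Y (P [ Q / X ])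

data _—[_]→_ {Σ : Set} : Expr Σ → Act Σ → Expr Σ → Set₁ where
  div-τ   : div —[ τ ]→ div
  pre     : ∀ {a P} → (a ⇒ P) —[ ev a ]→ P
  ⊓-l     : ∀ {P Q} → (P ⊓ Q) —[ τ ]→ P
  ⊓-r     : ∀ {P Q} → (P ⊓ Q) —[ τ ]→ Q
  □-l     : ∀ {P Q P' a} → P —[ ev a ]→ P' → (P □ Q) —[ ev a ]→ P'
  □-r     : ∀ {P Q P' a} → P —[ ev a ]→ P' → (Q □ P) —[ ev a ]→ P'
  ▷-ev    : ∀ {P Q P' a} → P —[ ev a ]→ P' → (P ▷ Q) —[ ev a ]→ P'
  □-τl    : ∀ {P Q P'} → P —[ τ ]→ P' → (P □ Q) —[ τ ]→ (P' □ Q)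
  □-τr    : ∀ {P Q P'} → P —[ τ ]→ P' → (Q □ P) —[ τ ]→ (Q □ P')
  ▷-τ     : ∀ {P Q P'} → P —[ τ ]→ P' → (P ▷ Q) —[ τ ]→ (P' ▷ Q)
  ▷-to    : ∀ {P Q} → (P ▷ Q) —[ τ ]→ Q
  ren-s   : ∀ {f P P' α} → P —[ α ]→ P' → ren f P —[ renAct f α ]→ ren f P'
  par-l   : ∀ {A P Q P' α} → P —[ α ]→ P' → ¬ (α ∈ₐ A) → par A P Q —[ α ]→ par A P' Q
  par-r   : ∀ {A P Q P' α} → P —[ α ]→ P' → ¬ (α ∈ₐ A) → par A Q P —[ α ]→ par A Q P'
  hide-v  : ∀ {A P P' α} → P —[ α ]→ P' → ¬ (α ∈ₐ A) → hide P A —[ α ]→ hide P' A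
  thr-v   : ∀ {A P Q P' α} → P —[ α ]→ P' → ¬ (α ∈ₐ A) → thr A P Q —[ α ]→ thr A P' Q
  par-s   : ∀ {A P Q P' Q' a} → P —[ ev a ]→ P' → Q —[ ev a ]→ Q' → A a
            → par A P Q —[ ev a ]→ par A P' Q'
  hide-h  : ∀ {A P P' a} → P —[ ev a ]→ P' → A a → hide P A —[ τ ]→ hide P' A
  thr-t   : ∀ {A P Q P' a} → P —[ ev a ]→ P' → A a → thr A P Q —[ ev a ]→ Q
  △-l     : ∀ {P Q P' α} → P —[ α ]→ P' → (P △ Q) —[ α ]→ (P' △ Q)
  △-τr    : ∀ {P Q Q'} → Q —[ τ ]→ Q' → (P △ Q) —[ τ ]→ (P △ Q')
  △-ev    : ∀ {P Q Q' a} → Q —[ ev a ]→ Q' → (P △ Q) —[ ev a ]→ Q'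
  μ-unf   : ∀ {X P} → μ X P —[ τ ]→ (P [ μ X P / X ])

data _⟹_ {Σ : Set} : Expr Σ → Expr Σ → Set₁ where
  ε   : ∀ {P} → P ⟹ P
  _◅_ : ∀ {P P' Q} → P —[ τ ]→ P' → P' ⟹ Q → P ⟹ Q

_=[_]⇒_ : {Σ : Set} → Expr Σ → Act Σ → Expr Σ → Set₁
P =[ α ]⇒ Q = ∃[ P' ] ∃[ Q' ] (P ⟹ P' × P' —[ α ]→ Q' × Q' ⟹ Q)

_=[_]⇒̂_ : {Σ : Set} → Expr Σ → Act Σ → Expr Σ → Set₁
P =[ τ ]⇒̂ Q    = P ⟹ Q
P =[ ev a ]⇒̂ Q = P =[ ev a ]⇒ Q

Diverges : {Σ : Set} → Expr Σ → Set₁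
Diverges P = Σ[ s ∈ (ℕ → Expr _) ] (P ⟹ s 0 × (∀ n → s n —[ τ ]→ s (suc n)))

record CoupledSimulation {Σ : Set} (R : Expr Σ → Expr Σ → Set₁) : Set₁ where
  field
    onProcesses : ∀ {P Q} → R P Q → Process P × Process Q
    simulate    : ∀ {P Q P' α} → R P Q → P —[ α ]→ P' → ∃[ Q' ] (Q =[ α ]⇒̂ Q' × R P' Q')
    coupled     : ∀ {P Q} → R P Q → ∃[ Q' ] (Q ⟹ Q' × R Q' P)

DivergencePreserving : {Σ : Set} (R : Expr Σ → Expr Σ → Set₁) → Set₁
DivergencePreserving R = ∀ {P Q} → R P Q → Diverges P → Diverges Q

_⊒CSΔ_ : {Σ : Set} → Expr Σ → Expr Σ → Set₂
P ⊒CSΔ Q = ∃[ R ] (CoupledSimulation R × DivergencePreserving R × R P Q)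

-- The witnessing relation is R₁ ∪ R₂ together with the root pair (P₁ ⊓ P₂, Q₁ ⊓ Q₂).
-- For coupling, the right root first moves silently to Q₁ and then along the coupling
-- of R₁ to some Q′ with Q′ R₁ P₁; the pair (Q′, P₁ ⊓ P₂) is added to the relation,
-- and it is a simulation pair because P₁ ⊓ P₂ can silently become P₁.
-- A divergence of P₁ ⊓ P₂ must pass through P₁ or P₂, whose divergence transfers.
module Submission where

open import Defs
open import Data.Nat using (suc)
open import Data.Product using (∃-syntax; _×_; _,_; proj₁; map₂)
open import Data.Sum using (_⊎_; inj₁; inj₂)

module _ {Σ : Set} where

  Process-⊓ : ∀ {P₁ P₂ : Expr Σ} → Process P₁ → Process P₂ → Process (P₁ ⊓ P₂)
  Process-⊓ p₁ p₂ X (f-⊓l free) = p₁ X free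
  Process-⊓ p₁ p₂ X (f-⊓r free) = p₂ X free

  τ-◅-weak : ∀ {P P′ Q : Expr Σ} α → P —[ τ ]→ P′ → P′ =[ α ]⇒̂ Q → P =[ α ]⇒̂ Q
  τ-◅-weak τ      step steps                           = step ◅ steps
  τ-◅-weak (ev a) step (R , R′ , before , act , after) = R , R′ , step ◅ before , act , after

  Diverges-τ-step : ∀ {P P′ : Expr Σ} → P —[ τ ]→ P′ → Diverges P′ → Diverges P
  Diverges-τ-step step (s , reach , loop) = s , step ◅ reach , loop

  Diverges-first-step : ∀ {P : Expr Σ} → Diverges P → ∃[ P′ ] (P —[ τ ]→ P′ × Diverges P′)
  Diverges-first-step (s , ε , loop)            = s 1 , loop 0 , (λ n → s (suc n)) , ε , (λ n → loop (suc n))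
  Diverges-first-step (s , step ◅ reach , loop) = _ , step , s , reach , loop

  Diverges-⊓ : ∀ {P₁ P₂ : Expr Σ} → Diverges (P₁ ⊓ P₂) → Diverges P₁ ⊎ Diverges P₂
  Diverges-⊓ d with Diverges-first-step d
  ... | _ , ⊓-l , d₁ = inj₁ d₁
  ... | _ , ⊓-r , d₂ = inj₂ d₂

  module InternalChoice
    {P₁ P₂ Q₁ Q₂ : Expr Σ}
    (pP₁ : Process P₁) (pP₂ : Process P₂) (pQ₁ : Process Q₁) (pQ₂ : Process Q₂)
    {R₁ R₂ : Expr Σ → Expr Σ → Set₁}
    (C₁ : CoupledSimulation R₁) (D₁ : DivergencePreserving R₁) (r₁ : R₁ P₁ Q₁)
    (C₂ : CoupledSimulation R₂) (D₂ : DivergencePreserving R₂) (r₂ : R₂ P₂ Q₂)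
    where
    module C₁ = CoupledSimulation C₁
    module C₂ = CoupledSimulation C₂

    data Rel : Expr Σ → Expr Σ → Set₁ where
      lift₁   : ∀ {P Q} → R₁ P Q → Rel P Q
      lift₂   : ∀ {P Q} → R₂ P Q → Rel P Q
      root    : Rel (P₁ ⊓ P₂) (Q₁ ⊓ Q₂)
      return₁ : ∀ {Q} → R₁ Q P₁ → Rel Q (P₁ ⊓ P₂)

    Rel-onProcesses : ∀ {P Q} → Rel P Q → Process P × Process Q
    Rel-onProcesses (lift₁ r)   = C₁.onProcesses r
    Rel-onProcesses (lift₂ r)   = C₂.onProcesses r
    Rel-onProcesses root        = Process-⊓ pP₁ pP₂ , Process-⊓ pQ₁ pQ₂
    Rel-onProcesses (return₁ r) = proj₁ (C₁.onProcesses r) , Process-⊓ pP₁ pP₂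

    Rel-simulate : ∀ {P Q P′ α} → Rel P Q → P —[ α ]→ P′ → ∃[ Q′ ] (Q =[ α ]⇒̂ Q′ × Rel P′ Q′)
    Rel-simulate (lift₁ r)   step = map₂ (map₂ lift₁) (C₁.simulate r step)
    Rel-simulate (lift₂ r)   step = map₂ (map₂ lift₂) (C₂.simulate r step)
    Rel-simulate root        ⊓-l  = Q₁ , ⊓-l ◅ ε , lift₁ r₁
    Rel-simulate root        ⊓-r  = Q₂ , ⊓-r ◅ ε , lift₂ r₂
    Rel-simulate (return₁ r) step with C₁.simulate r step
    ... | Q′ , weak , r′ = Q′ , τ-◅-weak _ ⊓-l weak , lift₁ r′

    Rel-coupled : ∀ {P Q} → Rel P Q → ∃[ Q′ ] (Q ⟹ Q′ × Rel Q′ P)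
    Rel-coupled (lift₁ r)   = map₂ (map₂ lift₁) (C₁.coupled r)
    Rel-coupled (lift₂ r)   = map₂ (map₂ lift₂) (C₂.coupled r)
    Rel-coupled root with C₁.coupled r₁
    ... | Q′ , steps , r′ = Q′ , ⊓-l ◅ steps , return₁ r′
    Rel-coupled (return₁ r) with C₁.coupled r
    ... | Q′ , steps , r′ = Q′ , ⊓-l ◅ steps , lift₁ r′

    Rel-coupledSimulation : CoupledSimulation Rel
    Rel-coupledSimulation = record
      { onProcesses = Rel-onProcesses
      ; simulate    = Rel-simulate
      ; coupled     = Rel-coupled
      }

    Rel-divergencePreserving : DivergencePreserving Rel
    Rel-divergencePreserving (lift₁ r)   d = D₁ r d
    Rel-divergencePreserving (lift₂ r)   d = D₂ r d
    Rel-divergencePreserving (return₁ r) d = Diverges-τ-step ⊓-l (D₁ r d)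
    Rel-divergencePreserving root        d with Diverges-⊓ d
    ... | inj₁ d₁ = Diverges-τ-step ⊓-l (D₁ r₁ d₁)
    ... | inj₂ d₂ = Diverges-τ-step ⊓-r (D₂ r₂ d₂)

proposition6 : {Σ : Set} (P₁ P₂ Q₁ Q₂ : Expr Σ)
    → Process P₁ → Process P₂ → Process Q₁ → Process Q₂
    → P₁ ⊒CSΔ Q₁ → P₂ ⊒CSΔ Q₂
    → (P₁ ⊓ P₂) ⊒CSΔ (Q₁ ⊓ Q₂)
proposition6 P₁ P₂ Q₁ Q₂ pP₁ pP₂ pQ₁ pQ₂ (R₁ , C₁ , D₁ , r₁) (R₂ , C₂ , D₂ , r₂) =
  Rel , Rel-coupledSimulation , Rel-divergencePreserving , root
  where open InternalChoice pP₁ pP₂ pQ₁ pQ₂ C₁ D₁ r₁ C₂ D₂ r₂
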